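{- Assume that the underlying order of $\mathcal{V}$ is linear (total), and consider a (symmetric) linear $\mathcal{V}\lambda$-theory. Replacing, in the deductive system defining its theorems, the rule "from $v=_{q_i}w$ for all $i\le n$ infer $v=_{\bigvee_{i} q_i}w$" by the axiom rule "$v=_\bot w$" (for all terms $v,w$ of the same type in the same context) does not change the class of theorems.
   Context: Standing assumptions on $\mathcal{V}$: commutative unital quantale (complete lattice with commutative associative $\otimes$ distributing over joins, unit $k$), integral ($k=\top$), continuous underlying lattice, with a fixed basis $B$ (for each $x$, $B\cap\{y\mid y\ll x\}$ is directed with join $x$, where $y\ll x$ means whenever $x\le\bigvee X$ some finite $A\subseteq X$ has $y\le\bigvee A$) closed under finite joins and $\otimes$ and containing $k$. A linear $\mathcal{V}\lambda$-theory $((G,\Sigma),Ax)$: linear $\lambda$-calculus over ground types $G$ and operation symbols $\Sigma$ ($f:A_1,\dots,A_n\to A$, $n\ge1$), with types $X\in G$, $I$, $A\otimes B$, $A\multimap B$ and terms $f(\vec v)$, variables, $\ast$, $v\ \mathtt{to}\ \ast.\,w$, $v\otimes w$, $\mathtt{pm}\ v\ \mathtt{to}\ x\otimes y.\,w$, $\lambda x.\,v$, $v\,w$ typed linearly; $Ax$ a class of $\mathcal{V}$-equations-in-context $\Gamma\rhd v=_q w:A$ with $q\in B$. Its theorems: the smallest class containing $Ax$, the equations $\mathtt{pm}\ v\otimes w\ \mathtt{to}\ x\otimes y.\,u=u[v/x,w/y]$, $\mathtt{pm}\ v\ \mathtt{to}\ x\otimes y.\,u[x\otimes y/z]=u[v/z]$,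 $\ast\ \mathtt{to}\ \ast.\,v=v$, $v\ \mathtt{to}\ \ast.\,w[\ast/z]=w[v/z]$, $(\lambda x.\,v)\,w=v[w/x]$, $\lambda x.(v\,x)=v$ and the commuting conversions $u[v\ \mathtt{to}\ \ast.\,w/z]=v\ \mathtt{to}\ \ast.\,u[w/z]$, $u[\mathtt{pm}\ v\ \mathtt{to}\ x\otimes y.\,w/z]=\mathtt{pm}\ v\ \mathtt{to}\ x\otimes y.\,u[w/z]$ (each $v=w$ read as $v=_\top w$ and $w=_\top v$), closed under: $v=_\top v$; $v=_q w,w=_r u\Rightarrow v=_{q\otimes r}u$; $v=_q w,r\le q\Rightarrow v=_r w$; (for all $r\ll q$, $v=_r w$) $\Rightarrow v=_q w$; the join rule (for all $i\le n$, $v=_{q_i}w$) $\Rightarrow v=_{\bigvee_i q_i}w$ with $n\ge0$; compatibility of $f$, $\otimes$, $\mathtt{pm}$, $\mathtt{to}$, application and substitution (labels combined by $\otimes$) and of $\lambda$ (label preserved); and permutation of contexts. A symmetric theory is one whose theorems are additionally closed under $v=_q w\Rightarrow w=_q v$. -}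

module Defs where

open import Data.Bool using (Bool; true)
open import Data.Empty using (⊥)
open import Data.Unit using (⊤)
open import Data.Nat using (ℕ)
open import Data.Fin using (Fin)
open import Data.List using (List; []; _∷_)
open import Data.List.Membership.Propositional using (_∈_)
open import Data.List.Relation.Unary.All using (All)
open import Data.Product using (Σ; _×_; _,_; proj₁; proj₂)
open import Data.Sum using (_⊎_; inj₁; inj₂)
open import Relation.Nullary using (¬_)
open import Relation.Binary.PropositionalEquality using (_≡_; refl; sym; cong; subst)

record Quantale : Set₁ where
  infix 4 _≤_
  infixl 7 _⊗_
  field
    V          : Set
    _≤_        : V → V → Set
    ≤-refl     : ∀ {x} → x ≤ x
    ≤-trans    : ∀ {x y z} → x ≤ y → y ≤ z → x ≤ z
    ≤-antisym  : ∀ {x y} → x ≤ y → y ≤ x → x ≡ y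
    ⋁          : (V → Set) → V
    ⋁-upper    : ∀ (S : V → Set) {x} → S x → x ≤ ⋁ S
    ⋁-least    : ∀ (S : V → Set) {y} → (∀ {x} → S x → x ≤ y) → ⋁ S ≤ y
    _⊗_        : V → V → V
    k          : V
    ⊗-assoc    : ∀ x y z → (x ⊗ y) ⊗ z ≡ x ⊗ (y ⊗ z)
    ⊗-comm     : ∀ x y → x ⊗ y ≡ y ⊗ x
    ⊗-identityˡ : ∀ x → k ⊗ x ≡ x
    ⊗-distrib-⋁ : ∀ x (S : V → Set) →
                  x ⊗ ⋁ S ≡ ⋁ (λ z → Σ V λ y → S y × z ≡ x ⊗ y)

module QNotions (Q : Quantale) where
  open Quantale Q

  top : V
  top = ⋁ (λ _ → ⊤)

  bot : V
  bot = ⋁ (λ _ → ⊥)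

  _∨_ : V → V → V
  x ∨ y = ⋁ (λ z → z ≡ x ⊎ z ≡ y)

  ⋁fin : List V → V
  ⋁fin A = ⋁ (λ z → z ∈ A)

  _≪_ : V → V → Set₁
  y ≪ x = ∀ (X : V → Set) → x ≤ ⋁ X →
          Σ (List V) λ A → All X A × y ≤ ⋁fin A

  Directed : (V → Set₁) → Set₁
  Directed D = Σ V D × (∀ x y → D x → D y → Σ V λ z → D z × x ≤ z × y ≤ z)

-- Standing assumptions: integral, continuous with a fixed basis B
record Standing (Q : Quantale) : Set₁ where
  open Quantale Q
  open QNotions Q
  field
    integral  : k ≡ top
    B         : V → Set
    B-directed : ∀ x → Directed (λ y → B y × y ≪ x)
    B-join-upper : ∀ x y → B y → y ≪ x → y ≤ x
    B-join-least : ∀ x u → (∀ y → B y → y ≪ x → y ≤ u) → x ≤ u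
    B-bot     : B bot
    B-∨       : ∀ {x y} → B x → B y → B (x ∨ y)
    B-⊗       : ∀ {x y} → B x → B y → B (x ⊗ y)
    B-k       : B k

Linear : Quantale → Set
Linear Q = ∀ x y → x ≤ y ⊎ y ≤ x
  where open Quantale Q

-- Linear λ-calculus

data Ty (G : Set) : Set where
  gnd  : G → Ty G
  I    : Ty G
  _⊗ᵗ_ : Ty G → Ty G → Ty G
  _⊸_  : Ty G → Ty G → Ty G

record Sig : Set₁ where
  field
    G   : Set
    Op  : Set
    ar  : Op → List (Ty G)
    cod : Op → Ty G
    ar-nonempty : ∀ f → ¬ (ar f ≡ [])

module Syntax (S : Sig) where
  open Sig S

  Ctx : Set
  Ctx = List (Ty G)

  -- Γ ∋ A ⊣ Γ' : Γ is Γ' with a variable of type A inserted at some position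
  data _∋_⊣_ : Ctx → Ty G → Ctx → Set where
    here  : ∀ {A Γ} → (A ∷ Γ) ∋ A ⊣ Γ
    there : ∀ {A B Γ Γ'} → Γ ∋ A ⊣ Γ' → (B ∷ Γ) ∋ A ⊣ (B ∷ Γ')

  -- Split Γ Δ₁ Δ₂ : Γ is an interleaving (shuffle) of Δ₁ and Δ₂
  data Split : Ctx → Ctx → Ctx → Set where
    done  : Split [] [] []
    left  : ∀ {A Γ Δ₁ Δ₂} → Split Γ Δ₁ Δ₂ → Split (A ∷ Γ) (A ∷ Δ₁) Δ₂
    right : ∀ {A Γ Δ₁ Δ₂} → Split Γ Δ₁ Δ₂ → Split (A ∷ Γ) Δ₁ (A ∷ Δ₂)

  mutual
    data Tm : Ctx → Ty G → Set where
      op   : ∀ {Γ} (f : Op) → Args Γ (ar f) → Tm Γ (cod f)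
      var  : ∀ {A} → Tm (A ∷ []) A
      ⋆    : Tm [] I
      to   : ∀ {Γ Δ₁ Δ₂ A} → Split Γ Δ₁ Δ₂ → Tm Δ₁ I → Tm Δ₂ A → Tm Γ A
      pair : ∀ {Γ Δ₁ Δ₂ A B} → Split Γ Δ₁ Δ₂ → Tm Δ₁ A → Tm Δ₂ B → Tm Γ (A ⊗ᵗ B)
      pm   : ∀ {Γ Δ₁ Δ₂ A B C} → Split Γ Δ₁ Δ₂ → Tm Δ₁ (A ⊗ᵗ B) →
             Tm (A ∷ B ∷ Δ₂) C → Tm Γ C
      lam  : ∀ {Γ A B} → Tm (A ∷ Γ) B → Tm Γ (A ⊸ B)
      app  : ∀ {Γ Δ₁ Δ₂ A B} → Split Γ Δ₁ Δ₂ → Tm Δ₁ (A ⊸ B) → Tm Δ₂ A → Tm Γ B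

    data Args : Ctx → List (Ty G) → Set where
      nil  : Args [] []
      cons : ∀ {Γ Δ₁ Δ₂ A As} → Split Γ Δ₁ Δ₂ → Tm Δ₁ A → Args Δ₂ As → Args Γ (A ∷ As)

  splitˡ-id : ∀ {Γ} → Split Γ Γ []
  splitˡ-id {[]} = done
  splitˡ-id {A ∷ Γ} = left splitˡ-id

  splitʳ-id : ∀ {Γ} → Split Γ [] Γ
  splitʳ-id {[]} = done
  splitʳ-id {A ∷ Γ} = right splitʳ-id

  emptyˡ : ∀ {Θ Δ} → Split Θ [] Δ → Θ ≡ Δ
  emptyˡ done = refl
  emptyˡ (right s) = cong (_ ∷_) (emptyˡ s)

  swap : ∀ {Γ X Y} → Split Γ X Y → Split Γ Y X
  swap done = done
  swap (left s) = right (swap s)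
  swap (right s) = left (swap s)

  locate : ∀ {Γ Γ' A Δ₁ Δ₂} → Γ ∋ A ⊣ Γ' → Split Γ Δ₁ Δ₂ →
           (Σ Ctx λ D → Δ₁ ∋ A ⊣ D × Split Γ' D Δ₂) ⊎
           (Σ Ctx λ D → Δ₂ ∋ A ⊣ D × Split Γ' Δ₁ D)
  locate here (left s) = inj₁ (_ , here , s)
  locate here (right s) = inj₂ (_ , here , s)
  locate (there p) (left s) with locate p s
  ... | inj₁ (D , q , t) = inj₁ (_ ∷ D , there q , left t)
  ... | inj₂ (D , q , t) = inj₂ (D , q , left t)
  locate (there p) (right s) with locate p s
  ... | inj₁ (D , q , t) = inj₁ (D , q , right t)
  ... | inj₂ (D , q , t) = inj₂ (_ ∷ D , there q , right t)

  assocL : ∀ {Θ Γ Δ X Y} → Split Θ Γ Δ → Split Γ X Y →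
           Σ Ctx λ E → Split Θ E Y × Split E X Δ
  assocL done done = [] , done , done
  assocL (left s) (left t) with assocL s t
  ... | E , u , v = _ ∷ E , left u , left v
  assocL (left s) (right t) with assocL s t
  ... | E , u , v = E , right u , v
  assocL (right s) t with assocL s t
  ... | E , u , v = _ ∷ E , left u , right v

  assocR : ∀ {Θ Γ Δ X Y} → Split Θ Γ Δ → Split Γ X Y →
           Σ Ctx λ E → Split Θ X E × Split E Y Δ
  assocR done done = [] , done , done
  assocR (left s) (left t) with assocR s t
  ... | E , u , v = E , left u , v
  assocR (left s) (right t) with assocR s t
  ... | E , u , v = _ ∷ E , right u , left v
  assocR (right s) t with assocR s t
  ... | E , u , v = _ ∷ E , right u , right v

  mid : ∀ {Γ X Δ Y Z} → Split Γ X Δ → Split Δ Y Z →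
        Σ Ctx λ E → Split Γ Y E × Split E X Z
  mid done done = [] , done , done
  mid (left s) t with mid s t
  ... | E , u , v = _ ∷ E , right u , left v
  mid (right s) (left t) with mid s t
  ... | E , u , v = E , left u , v
  mid (right s) (right t) with mid s t
  ... | E , u , v = _ ∷ E , right u , right v

  pmL : ∀ {Γ Δ₁ Δ₂ X Y} → Split Γ Δ₁ Δ₂ → Split Δ₁ X Y →
        Σ Ctx λ E → Split Γ E Y × Split E Δ₂ X
  pmL done done = [] , done , done
  pmL (left s) (left t) with pmL s t
  ... | E , u , v = _ ∷ E , left u , right v
  pmL (left s) (right t) with pmL s t
  ... | E , u , v = E , right u , v
  pmL (right s) t with pmL s t
  ... | E , u , v = _ ∷ E , left u , left v

  -- linear substitution  u[v/x]:  Γ,x:A ⊢ u : B  and  Δ ⊢ v : A  give  Θ ⊢ u[v/x] : B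
  -- (x at the position given by p, Θ an interleaving of Γ and Δ)
  mutual
    sub : ∀ {Γ Γ' Δ Θ A B} → Γ ∋ A ⊣ Γ' → Tm Γ B → Tm Δ A → Split Θ Γ' Δ → Tm Θ B
    sub p (op f as) v s = op f (subArgs p as v s)
    sub here var v s = subst (λ Θ → Tm Θ _) (sym (emptyˡ s)) v
    sub (there ()) var v s
    sub () ⋆ v s
    sub p (to t a b) v s with locate p t
    ... | inj₁ (D , q , t') =
      let r = assocL s t' in to (proj₁ (proj₂ r)) (sub q a v (proj₂ (proj₂ r))) b
    ... | inj₂ (D , q , t') =
      let r = assocR s t' in to (proj₁ (proj₂ r)) a (sub q b v (proj₂ (proj₂ r)))
    sub p (pair t a b) v s with locate p t
    ... | inj₁ (D , q , t') =
      let r = assocL s t' in pair (proj₁ (proj₂ r)) (sub q a v (proj₂ (proj₂ r))) b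
    ... | inj₂ (D , q , t') =
      let r = assocR s t' in pair (proj₁ (proj₂ r)) a (sub q b v (proj₂ (proj₂ r)))
    sub p (pm t a b) v s with locate p t
    ... | inj₁ (D , q , t') =
      let r = assocL s t' in pm (proj₁ (proj₂ r)) (sub q a v (proj₂ (proj₂ r))) b
    ... | inj₂ (D , q , t') =
      let r = assocR s t' in
      pm (proj₁ (proj₂ r)) a (sub (there (there q)) b v (left (left (proj₂ (proj₂ r)))))
    sub p (lam b) v s = lam (sub (there p) b v (left s))
    sub p (app t a b) v s with locate p t
    ... | inj₁ (D , q , t') =
      let r = assocL s t' in app (proj₁ (proj₂ r)) (sub q a v (proj₂ (proj₂ r))) b
    ... | inj₂ (D , q , t') =
      let r = assocR s t' in app (proj₁ (proj₂ r)) a (sub q b v (proj₂ (proj₂ r)))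

    subArgs : ∀ {Γ Γ' Δ Θ A Bs} → Γ ∋ A ⊣ Γ' → Args Γ Bs → Tm Δ A → Split Θ Γ' Δ → Args Θ Bs
    subArgs () nil v s
    subArgs p (cons t a as) v s with locate p t
    ... | inj₁ (D , q , t') =
      let r = assocL s t' in cons (proj₁ (proj₂ r)) (sub q a v (proj₂ (proj₂ r))) as
    ... | inj₂ (D , q , t') =
      let r = assocR s t' in cons (proj₁ (proj₂ r)) a (subArgs q as v (proj₂ (proj₂ r)))

  -- right-hand side of the pm-β equation:  u[v/x, w/y]
  pmβ-rhs : ∀ {Γ Δ₁ Δ₂ Δa Δb A B C} → Split Γ Δ₁ Δ₂ → Split Δ₁ Δa Δb →
            Tm Δa A → Tm Δb B → Tm (A ∷ B ∷ Δ₂) C → Tm Γ C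
  pmβ-rhs s s' v w u =
    let r = pmL s s' in
    sub here (sub here u v (left (proj₂ (proj₂ r)))) w (proj₁ (proj₂ r))

  data Basic : ∀ {Γ A} → Tm Γ A → Tm Γ A → Set where
    pm-β : ∀ {Γ Δ₁ Δ₂ Δa Δb A B C} (s : Split Γ Δ₁ Δ₂) (s' : Split Δ₁ Δa Δb)
           (v : Tm Δa A) (w : Tm Δb B) (u : Tm (A ∷ B ∷ Δ₂) C) →
           Basic (pm s (pair s' v w) u) (pmβ-rhs s s' v w u)
    pm-η : ∀ {Γ Γu Γ₀ Δ A B C} (p : Γu ∋ (A ⊗ᵗ B) ⊣ Γ₀) (u : Tm Γu C)
           (v : Tm Δ (A ⊗ᵗ B)) (s : Split Γ Δ Γ₀) →
           Basic (pm s v (sub p u (pair (left (right done)) var var) (right (right splitˡ-id))))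
                 (sub p u v (swap s))
    unit-β : ∀ {Γ A} (v : Tm Γ A) → Basic (to splitʳ-id ⋆ v) v
    unit-η : ∀ {Γ Γw Γ₀ Δ A} (p : Γw ∋ I ⊣ Γ₀) (w : Tm Γw A) (v : Tm Δ I)
             (s : Split Γ Δ Γ₀) →
             Basic (to s v (sub p w ⋆ splitˡ-id)) (sub p w v (swap s))
    ⊸-β : ∀ {Γ Γ₁ Δ A B} (v : Tm (A ∷ Γ₁) B) (w : Tm Δ A) (s : Split Γ Γ₁ Δ) →
          Basic (app s (lam v) w) (sub here v w s)
    ⊸-η : ∀ {Γ A B} (v : Tm Γ (A ⊸ B)) → Basic (lam (app (right splitˡ-id) v var)) v
    cc-to : ∀ {Γ Γu Γ₀ Δ Δv Δw A C} (p : Γu ∋ A ⊣ Γ₀) (u : Tm Γu C)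
            (v : Tm Δv I) (w : Tm Δw A) (t : Split Δ Δv Δw) (s : Split Γ Γ₀ Δ) →
            Basic (sub p u (to t v w) s)
                  (to (proj₁ (proj₂ (mid s t))) v (sub p u w (proj₂ (proj₂ (mid s t)))))
    cc-pm : ∀ {Γ Γu Γ₀ Δ Δv Δw A B C D} (p : Γu ∋ D ⊣ Γ₀) (u : Tm Γu C)
            (v : Tm Δv (A ⊗ᵗ B)) (w : Tm (A ∷ B ∷ Δw) D) (t : Split Δ Δv Δw)
            (s : Split Γ Γ₀ Δ) →
            Basic (sub p u (pm t v w) s)
                  (pm (proj₁ (proj₂ (mid s t))) v
                      (sub p u w (right (right (proj₂ (proj₂ (mid s t)))))))

-- Linear Vλ-theories and their theorems

record Theory (Q : Quantale) (St : Standing Q) (S : Sig) : Set₁ where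
  open Quantale Q
  open Standing St
  open Syntax S
  field
    Ax       : ∀ {Γ A} → V → Tm Γ A → Tm Γ A → Set
    Ax-basis : ∀ {Γ A q} {v w : Tm Γ A} → Ax q v w → B q

-- which of the two rules is present in the deductive system
data Rule : Set where
  joinRule botAxiom : Rule

-- symmetric = true : the theorems are additionally closed under symmetry
module Deduction (Q : Quantale) (St : Standing Q) (S : Sig) (T : Theory Q St S)
                 (symmetric : Bool) (rule : Rule) where
  open Quantale Q
  open QNotions Q
  open Sig S
  open Syntax S
  open Theory T

  mutual
    data Thm : ∀ {Γ A} → V → Tm Γ A → Tm Γ A → Set₁ where
      axiom     : ∀ {Γ A q} {v w : Tm Γ A} → Ax q v w → Thm q v w
      basic     : ∀ {Γ A} {v w : Tm Γ A} → Basic v w → Thm top v w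
      basic-sym : ∀ {Γ A} {v w : Tm Γ A} → Basic v w → Thm top w v
      refl≈     : ∀ {Γ A} {v : Tm Γ A} → Thm top v v
      trans≈    : ∀ {Γ A q r} {v w u : Tm Γ A} → Thm q v w → Thm r w u → Thm (q ⊗ r) v u
      weaken    : ∀ {Γ A q r} {v w : Tm Γ A} → Thm q v w → r ≤ q → Thm r v w
      arch      : ∀ {Γ A q} {v w : Tm Γ A} → (∀ r → r ≪ q → Thm r v w) → Thm q v w
      join      : ∀ {Γ A} {v w : Tm Γ A} → rule ≡ joinRule →
                  (n : ℕ) (qs : Fin n → V) → (∀ i → Thm (qs i) v w) →
                  Thm (⋁ (λ x → Σ (Fin n) λ i → qs i ≡ x)) v w
      bot-ax    : ∀ {Γ A} {v w : Tm Γ A} → rule ≡ botAxiom → Thm bot v w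
      symm      : ∀ {Γ A q} {v w : Tm Γ A} → symmetric ≡ true → Thm q v w → Thm q w v
      cong-op   : ∀ {Γ q} (f : Op) {as bs : Args Γ (ar f)} →
                  ThmArgs q as bs → Thm q (op f as) (op f bs)
      cong-to   : ∀ {Γ Δ₁ Δ₂ A q r} (s : Split Γ Δ₁ Δ₂) {v v' : Tm Δ₁ I} {w w' : Tm Δ₂ A} →
                  Thm q v v' → Thm r w w' → Thm (q ⊗ r) (to s v w) (to s v' w')
      cong-pair : ∀ {Γ Δ₁ Δ₂ A B q r} (s : Split Γ Δ₁ Δ₂) {v v' : Tm Δ₁ A} {w w' : Tm Δ₂ B} →
                  Thm q v v' → Thm r w w' → Thm (q ⊗ r) (pair s v w) (pair s v' w')
      cong-pm   : ∀ {Γ Δ₁ Δ₂ A B C q r} (s : Split Γ Δ₁ Δ₂) {v v' : Tm Δ₁ (A ⊗ᵗ B)}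
                  {w w' : Tm (A ∷ B ∷ Δ₂) C} →
                  Thm q v v' → Thm r w w' → Thm (q ⊗ r) (pm s v w) (pm s v' w')
      cong-app  : ∀ {Γ Δ₁ Δ₂ A B q r} (s : Split Γ Δ₁ Δ₂) {v v' : Tm Δ₁ (A ⊸ B)} {w w' : Tm Δ₂ A} →
                  Thm q v v' → Thm r w w' → Thm (q ⊗ r) (app s v w) (app s v' w')
      cong-lam  : ∀ {Γ A B q} {v w : Tm (A ∷ Γ) B} → Thm q v w → Thm q (lam v) (lam w)
      cong-sub  : ∀ {Γ Γ' Δ Θ A B q r} (p : Γ ∋ A ⊣ Γ') (s : Split Θ Γ' Δ)
                  {u u' : Tm Γ B} {v v' : Tm Δ A} →
                  Thm q u u' → Thm r v v' → Thm (q ⊗ r) (sub p u v s) (sub p u' v' s)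
      -- permutation of contexts, generated by moving one variable to any position
      perm      : ∀ {Γ Γ₀ Θ A B q} (p : Γ ∋ A ⊣ Γ₀) (s : Split Θ Γ₀ (A ∷ []))
                  {v w : Tm Γ B} → Thm q v w → Thm q (sub p v var s) (sub p w var s)

    data ThmArgs : ∀ {Γ As} → V → Args Γ As → Args Γ As → Set₁ where
      nil  : ThmArgs k nil nil
      cons : ∀ {Γ Δ₁ Δ₂ A As q r} (s : Split Γ Δ₁ Δ₂) {v w : Tm Δ₁ A} {as bs : Args Δ₂ As} →
             Thm q v w → ThmArgs r as bs → ThmArgs (q ⊗ r) (cons s v as) (cons s w bs)

{-# OPTIONS --safe #-}
-- The two systems differ in a single rule, and each rule is derivable in the
-- other system. An empty join is ⊥, so v =_⊥ w is an instance of the join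
-- rule. Conversely, in a linear order a nonempty finite join is attained by
-- one of the labels, so the join rule is an instance of weakening; the
-- remaining case, the empty join, is an instance of the ⊥ axiom.
module Submission where

open import Defs
open import Data.Bool using (Bool)
open import Function.Bundles using (_⇔_; mk⇔)
open import Data.Nat using (ℕ; zero; suc)
open import Data.Fin using (Fin; zero; suc)
open import Data.Product using (Σ; _,_)
open import Data.Sum using (inj₁; inj₂)
open import Relation.Binary.PropositionalEquality using (_≡_; refl)

module FiniteJoins (Q : Quantale) where
  open Quantale Q
  open QNotions Q

  ⋁ᶠ : (n : ℕ) → (Fin n → V) → V
  ⋁ᶠ n qs = ⋁ (λ x → Σ (Fin n) λ i → qs i ≡ x)

  bot-least : ∀ x → bot ≤ x
  bot-least x = ⋁-least _ (λ ())

  ⋁ᶠ-empty : (qs : Fin 0 → V) → ⋁ᶠ 0 qs ≤ bot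
  ⋁ᶠ-empty qs = ⋁-least _ (λ { (() , _) })

  module _ (linear : Linear Q) where

    argmax : (n : ℕ) (qs : Fin (suc n) → V) → Σ (Fin (suc n)) λ i → ∀ j → qs j ≤ qs i
    argmax zero qs = zero , λ { zero → ≤-refl }
    argmax (suc n) qs with argmax n (λ j → qs (suc j))
    ... | i , qs≤qsᵢ with linear (qs zero) (qs (suc i))
    ... | inj₁ q₀≤ = suc i , λ { zero → q₀≤ ; (suc j) → qs≤qsᵢ j }
    ... | inj₂ ≤q₀ = zero , λ { zero → ≤-refl ; (suc j) → ≤-trans (qs≤qsᵢ j) ≤q₀ }

    ⋁ᶠ-attained : (n : ℕ) (qs : Fin (suc n) → V) → Σ (Fin (suc n)) λ i → ⋁ᶠ (suc n) qs ≤ qs i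
    ⋁ᶠ-attained n qs with argmax n qs
    ... | i , qs≤qsᵢ = i , ⋁-least _ (λ { (j , refl) → qs≤qsᵢ j })

module Simulation (Q : Quantale) (St : Standing Q) (S : Sig) (T : Theory Q St S)
                  (symmetric : Bool) (rule rule′ : Rule) where
  open Quantale Q
  open QNotions Q
  open FiniteJoins Q using (⋁ᶠ)
  open Syntax S using (Tm; Args)
  open Deduction Q St S T symmetric rule
  module D′ = Deduction Q St S T symmetric rule′

  module _ (join⇒ : rule ≡ joinRule → ∀ {Γ A} {v w : Tm Γ A} (n : ℕ) (qs : Fin n → V) →
                    (∀ i → D′.Thm (qs i) v w) → D′.Thm (⋁ᶠ n qs) v w)
           (bot⇒ : rule ≡ botAxiom → ∀ {Γ A} {v w : Tm Γ A} → D′.Thm bot v w) where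
    mutual
      translate : ∀ {Γ A q} {v w : Tm Γ A} → Thm q v w → D′.Thm q v w
      translate (axiom ax) = D′.axiom ax
      translate (basic b) = D′.basic b
      translate (basic-sym b) = D′.basic-sym b
      translate refl≈ = D′.refl≈
      translate (trans≈ d e) = D′.trans≈ (translate d) (translate e)
      translate (weaken d r≤q) = D′.weaken (translate d) r≤q
      translate (arch ds) = D′.arch (λ r r≪q → translate (ds r r≪q))
      translate (join eq n qs ds) = join⇒ eq n qs (λ i → translate (ds i))
      translate (bot-ax eq) = bot⇒ eq
      translate (symm eq d) = D′.symm eq (translate d)
      translate (cong-op f ds) = D′.cong-op f (translateArgs ds)
      translate (cong-to s d e) = D′.cong-to s (translate d) (translate e)
      translate (cong-pair s d e) = D′.cong-pair s (translate d) (translate e)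
      translate (cong-pm s d e) = D′.cong-pm s (translate d) (translate e)
      translate (cong-app s d e) = D′.cong-app s (translate d) (translate e)
      translate (cong-lam d) = D′.cong-lam (translate d)
      translate (cong-sub p s d e) = D′.cong-sub p s (translate d) (translate e)
      translate (perm p s d) = D′.perm p s (translate d)

      translateArgs : ∀ {Γ As q} {as bs : Args Γ As} → ThmArgs q as bs → D′.ThmArgs q as bs
      translateArgs nil = D′.nil
      translateArgs (cons s d ds) = D′.cons s (translate d) (translateArgs ds)

module _ (Q : Quantale) (St : Standing Q) (linear : Linear Q)
         (S : Sig) (T : Theory Q St S) (symmetric : Bool) where
  open Quantale Q
  open QNotions Q using (bot)
  open FiniteJoins Q
  open Syntax S using (Tm)
  private
    module J = Deduction Q St S T symmetric joinRule
    module Bt = Deduction Q St S T symmetric botAxiom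

  join-derivable : ∀ {Γ A} {v w : Tm Γ A} (n : ℕ) (qs : Fin n → V) →
                   (∀ i → Bt.Thm (qs i) v w) → Bt.Thm (⋁ᶠ n qs) v w
  join-derivable zero qs _ = Bt.weaken (Bt.bot-ax refl) (⋁ᶠ-empty qs)
  join-derivable (suc n) qs ds with ⋁ᶠ-attained linear n qs
  ... | i , ⋁≤qsᵢ = Bt.weaken (ds i) ⋁≤qsᵢ

  bot-derivable : ∀ {Γ A} {v w : Tm Γ A} → J.Thm bot v w
  bot-derivable = J.weaken (J.join refl zero (λ ()) (λ ())) (bot-least _)

  join⇒botAxiom : ∀ {Γ A q} {v w : Tm Γ A} → J.Thm q v w → Bt.Thm q v w
  join⇒botAxiom = Simulation.translate Q St S T symmetric joinRule botAxiom
                    (λ _ → join-derivable) (λ ())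

  botAxiom⇒join : ∀ {Γ A q} {v w : Tm Γ A} → Bt.Thm q v w → J.Thm q v w
  botAxiom⇒join = Simulation.translate Q St S T symmetric botAxiom joinRule
                    (λ ()) (λ _ → bot-derivable)

theoremA1 : (Q : Quantale) (St : Standing Q) → Linear Q →
            (S : Sig) (T : Theory Q St S) (symmetric : Bool) →
            {Γ : Syntax.Ctx S} {A : Ty (Sig.G S)} (q : Quantale.V Q)
            (v w : Syntax.Tm S Γ A) →
            Deduction.Thm Q St S T symmetric joinRule q v w
              ⇔ Deduction.Thm Q St S T symmetric botAxiom q v w
theoremA1 Q St linear S T symmetric q v w =
  mk⇔ (join⇒botAxiom Q St linear S T symmetric) (botAxiom⇒join Q St linear S T symmetric)
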